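{- The relation $\approx$ on terms is transitive, reflexive, symmetric, monotonic and stable. That is, for all terms $s,t,u$: (i) if $s \approx t$ and $t \approx u$ then $s \approx u$; (ii) $s \approx s$; (iii) if $s \approx t$ then $t \approx s$; (iv) if $s, s' :: \sigma \Rightarrow \tau$ and $t, t' :: \sigma$ with $s \approx s'$ and $t \approx t'$, then $s\ t \approx s'\ t'$; (v) if $s \approx t$ and $\gamma$ is a (type-preserving) substitution, then $s\gamma \approx t\gamma$.
   Context: Simply typed terms: there is a single base type (sort) $\iota$; types are $\iota$ and $\sigma \Rightarrow \tau$. Given a set of typed variables (infinitely many of each type) and a possibly infinite set of typed function symbols, terms are built from variables and function symbols by type-respecting application: if $s :: \sigma \Rightarrow \tau$ and $t :: \sigma$ then $s\ t :: \tau$ (application is left-associative). Every term has the form $a\ s_1 \cdots s_n$ ($n \geq 0$) with $a$ a variable or a function symbol. Fixed data: a precedence $\unrhd$, i.e. a quasi-ordering on function symbols whose strict part $\rhd$ ($\mathsf{f} \rhd \mathsf{g}$ iff $\mathsf{f} \unrhd \mathsf{g}$ and not $\mathsf{g} \unrhd \mathsf{f}$) is well-founded, with $\equiv$ denoting $\unrhd \cap \unlhd$; and a filter $\pi$ assigning to each function symbol $\mathsf{f} :: \sigma_1 \Rightarrow \dots \Rightarrow \sigma_m \Rightarrow \iota$ a subset $\pi(\mathsf{f}) \subseteq \{1,\dots,m\}$. The relation $\approx$ is defined inductively: $s \approx t$ holds iff $s$ and $t$ have the same type and either (Eq-mono) $s = x\ s_1 \cdots s_n$ and $t = x\ t_1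 \cdots t_n$ for a variable $x$ and $s_i \approx t_i$ for all $i$; or (Eq-args) $s = \mathsf{f}\ s_1 \cdots s_n$ and $t = \mathsf{g}\ t_1 \cdots t_n$ for function symbols $\mathsf{f},\mathsf{g}$ of the same type with $\mathsf{f} \equiv \mathsf{g}$, $\pi(\mathsf{f}) = \pi(\mathsf{g})$, and $s_i \approx t_i$ for all $i \in \pi(\mathsf{f}) \cap \{1,\dots,n\}$. -}

module Defs where

open import Data.Nat using (ℕ; suc; _≤_)
open import Data.Bool using (Bool; true)
open import Data.Product using (Σ; _×_; _,_; proj₁)
open import Relation.Nullary using (¬_)
open import Relation.Binary.PropositionalEquality using (_≡_)
open import Relation.Binary.Structures using (IsPreorder)
open import Induction.WellFounded using (WellFounded)

infixr 7 _⇒_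
data Ty : Set where
  ι   : Ty
  _⇒_ : Ty → Ty → Ty

arity : Ty → ℕ
arity ι       = 0
arity (_ ⇒ τ) = suc (arity τ)

record Setting : Set₁ where
  field
    Fun : Ty → Set

  FSym : Set
  FSym = Σ Ty Fun

  field
    _⊵_          : FSym → FSym → Set
    ⊵-isPreorder : IsPreorder _≡_ _⊵_

  _▷_ : FSym → FSym → Set
  f ▷ g = f ⊵ g × ¬ (g ⊵ f)

  _≡ᵖ_ : FSym → FSym → Set
  f ≡ᵖ g = f ⊵ g × g ⊵ f

  field
    ▷-wellFounded : WellFounded (λ g f → f ▷ g)
    -- the filter: π f i ≡ true  means  i ∈ π(f)
    π       : FSym → ℕ → Bool
    π-range : ∀ f i → π f i ≡ true → 1 ≤ i × i ≤ arity (proj₁ f)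

-- Terms (intrinsically typed).  Variables of type σ are indexed by ℕ,
-- giving infinitely many variables of each type.

module Terms (S : Setting) where
  open Setting S

  infixl 9 _·_
  data Tm : Ty → Set where
    var : ∀ {σ} → ℕ → Tm σ
    fun : ∀ {σ} → Fun σ → Tm σ
    _·_ : ∀ {σ τ} → Tm (σ ⇒ τ) → Tm σ → Tm τ

  -- argument lists: Args σ τ is a list s₁ … sₙ such that
  -- a s₁ ⋯ sₙ :: τ whenever a :: σ
  infixr 5 _∷_
  data Args : Ty → Ty → Set where
    []  : ∀ {σ} → Args σ σ
    _∷_ : ∀ {σ τ ρ} → Tm σ → Args τ ρ → Args (σ ⇒ τ) ρ

  apply : ∀ {σ τ} → Tm σ → Args σ τ → Tm τ
  apply a []       = a
  apply a (s ∷ ss) = apply (a · s) ss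

  Subst : Set
  Subst = ∀ σ → ℕ → Tm σ

  _[_] : ∀ {σ} → Tm σ → Subst → Tm σ
  var {σ} x [ γ ] = γ σ x
  fun f     [ γ ] = fun f
  (s · t)   [ γ ] = (s [ γ ]) · (t [ γ ])

  infix 4 _≈_
  data _≈_ : ∀ {σ} → Tm σ → Tm σ → Set
  data AllArgs≈ : ∀ {σ τ} → Args σ τ → Args σ τ → Set
  -- arguments related at the positions i (counting from the given
  -- start index) with P i ≡ true
  data FilteredArgs≈ (P : ℕ → Bool) : ∀ {σ τ} → ℕ → Args σ τ → Args σ τ → Set

  data _≈_ where
    eq-mono : ∀ {σ τ} (x : ℕ) {ss ts : Args σ τ} →
              AllArgs≈ ss ts →
              apply (var x) ss ≈ apply (var x) ts
    eq-args : ∀ {σ τ} (f g : Fun σ) {ss ts : Args σ τ} →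
              (σ , f) ≡ᵖ (σ , g) →
              (∀ i → π (σ , f) i ≡ π (σ , g) i) →
              FilteredArgs≈ (π (σ , f)) 1 ss ts →
              apply (fun f) ss ≈ apply (fun g) ts

  data AllArgs≈ where
    []  : ∀ {σ} → AllArgs≈ {σ} [] []
    _∷_ : ∀ {σ τ ρ} {s t : Tm σ} {ss ts : Args τ ρ} →
          s ≈ t → AllArgs≈ ss ts → AllArgs≈ (s ∷ ss) (t ∷ ts)

  data FilteredArgs≈ P where
    []  : ∀ {σ i} → FilteredArgs≈ P {σ} i [] []
    _∷_ : ∀ {σ τ ρ i} {s t : Tm σ} {ss ts : Args τ ρ} →
          (P i ≡ true → s ≈ t) → FilteredArgs≈ P (suc i) ss ts →
          FilteredArgs≈ P i (s ∷ ss) (t ∷ ts)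

{-# OPTIONS --safe #-}
module Submission where

open import Defs
open import Data.Product using (_×_; _,_; swap)
open import Data.Nat using (ℕ; suc)
open import Data.Bool using (Bool; true)
open import Data.Empty using (⊥)
open import Relation.Binary.PropositionalEquality using (_≡_; _≗_; refl; sym; trans)
open import Relation.Binary.Structures using (IsPreorder)

-- Since ≈ is indexed by `apply a ss`, which is not a constructor form, a proof of
-- s ≈ t cannot be inverted by matching on s.  We therefore pass to an equivalent
-- relation ≈ˢ that reads the application spine one argument at a time, from the
-- head outwards; all five properties are then structural inductions on ≈ˢ.  For
-- transitivity, the shared middle term forces both proofs to have heads of the
-- same kind (variable or symbol) and, for symbols, to agree on the middle symbol
-- and on the argument position reached.

module SpineEquivalence (S : Setting) where
  open Setting S
  open Terms S
  module ⊵ = IsPreorder ⊵-isPreorder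

  ≡ᵖ-refl : ∀ f → f ≡ᵖ f
  ≡ᵖ-refl f = ⊵.refl , ⊵.refl

  ≡ᵖ-trans : ∀ {f g h} → f ≡ᵖ g → g ≡ᵖ h → f ≡ᵖ h
  ≡ᵖ-trans (f⊵g , g⊵f) (g⊵h , h⊵g) = ⊵.trans f⊵g g⊵h , ⊵.trans h⊵g g⊵f

  infix 4 _≈ˢ_
  data VarSpine≈ : ∀ {σ} → Tm σ → Tm σ → Set
  -- FunSpine≈ f g P i relates f s₁ ⋯ sᵢ₋₁ and g t₁ ⋯ tᵢ₋₁, so i is the
  -- position of the next argument.
  data FunSpine≈ {ρ} (f g : Fun ρ) (P : ℕ → Bool) : ℕ → ∀ {σ} → Tm σ → Tm σ → Set
  data _≈ˢ_ : ∀ {σ} → Tm σ → Tm σ → Set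

  data VarSpine≈ where
    var-head : ∀ {σ} (x : ℕ) → VarSpine≈ {σ} (var x) (var x)
    var-app  : ∀ {σ τ} {s s′ : Tm (σ ⇒ τ)} {t t′ : Tm σ} →
               VarSpine≈ s s′ → t ≈ˢ t′ → VarSpine≈ (s · t) (s′ · t′)

  data FunSpine≈ f g P where
    fun-head : FunSpine≈ f g P 1 (fun f) (fun g)
    fun-app  : ∀ {i σ τ} {s s′ : Tm (σ ⇒ τ)} {t t′ : Tm σ} →
               FunSpine≈ f g P i s s′ → (P i ≡ true → t ≈ˢ t′) →
               FunSpine≈ f g P (suc i) (s · t) (s′ · t′)

  data _≈ˢ_ where
    var-spine : ∀ {σ} {s t : Tm σ} → VarSpine≈ s t → s ≈ˢ t
    fun-spine : ∀ {ρ σ} (f g : Fun ρ) {i} {s t : Tm σ} →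
                (ρ , f) ≡ᵖ (ρ , g) → π (ρ , f) ≗ π (ρ , g) →
                FunSpine≈ f g (π (ρ , f)) i s t → s ≈ˢ t

  ≈⇒≈ˢ : ∀ {σ} {s t : Tm σ} → s ≈ t → s ≈ˢ t
  ≈ˢ-apply-var : ∀ {σ τ} {a b : Tm σ} {ss ts : Args σ τ} →
                 VarSpine≈ a b → AllArgs≈ ss ts → apply a ss ≈ˢ apply b ts
  ≈ˢ-apply-fun : ∀ {ρ σ τ} {f g : Fun ρ} {i} {a b : Tm σ} {ss ts : Args σ τ} →
                 (ρ , f) ≡ᵖ (ρ , g) → π (ρ , f) ≗ π (ρ , g) →
                 FunSpine≈ f g (π (ρ , f)) i a b → FilteredArgs≈ (π (ρ , f)) i ss ts →
                 apply a ss ≈ˢ apply b ts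

  ≈⇒≈ˢ (eq-mono x ss≈ts)              = ≈ˢ-apply-var (var-head x) ss≈ts
  ≈⇒≈ˢ (eq-args f g f≡g πf≗πg ss≈ts) = ≈ˢ-apply-fun f≡g πf≗πg fun-head ss≈ts

  ≈ˢ-apply-var a≈b []             = var-spine a≈b
  ≈ˢ-apply-var a≈b (s≈t ∷ ss≈ts) = ≈ˢ-apply-var (var-app a≈b (≈⇒≈ˢ s≈t)) ss≈ts

  ≈ˢ-apply-fun {f = f} {g} f≡g πf≗πg a≈b [] = fun-spine f g f≡g πf≗πg a≈b
  ≈ˢ-apply-fun f≡g πf≗πg a≈b (s≈t ∷ ss≈ts) =
    ≈ˢ-apply-fun f≡g πf≗πg (fun-app a≈b (λ i∈π → ≈⇒≈ˢ (s≈t i∈π))) ss≈ts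

  ≈ˢ⇒≈ : ∀ {σ} {s t : Tm σ} → s ≈ˢ t → s ≈ t
  ≈-apply-var : ∀ {σ τ} {a b : Tm σ} {ss ts : Args σ τ} →
                VarSpine≈ a b → AllArgs≈ ss ts → apply a ss ≈ apply b ts
  ≈-apply-fun : ∀ {ρ σ τ} {f g : Fun ρ} {i} {a b : Tm σ} {ss ts : Args σ τ} →
                (ρ , f) ≡ᵖ (ρ , g) → π (ρ , f) ≗ π (ρ , g) →
                FunSpine≈ f g (π (ρ , f)) i a b → FilteredArgs≈ (π (ρ , f)) i ss ts →
                apply a ss ≈ apply b ts

  ≈ˢ⇒≈ (var-spine s≈t)                = ≈-apply-var s≈t []
  ≈ˢ⇒≈ (fun-spine _ _ f≡g πf≗πg s≈t) = ≈-apply-fun f≡g πf≗πg s≈t []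

  ≈-apply-var (var-head x)      ss≈ts = eq-mono x ss≈ts
  ≈-apply-var (var-app a≈b s≈t) ss≈ts = ≈-apply-var a≈b (≈ˢ⇒≈ s≈t ∷ ss≈ts)

  ≈-apply-fun {f = f} {g} f≡g πf≗πg fun-head ss≈ts = eq-args f g f≡g πf≗πg ss≈ts
  ≈-apply-fun f≡g πf≗πg (fun-app a≈b s≈t) ss≈ts =
    ≈-apply-fun f≡g πf≗πg a≈b ((λ i∈π → ≈ˢ⇒≈ (s≈t i∈π)) ∷ ss≈ts)

  ≈ˢ-mono : ∀ {σ τ} {s s′ : Tm (σ ⇒ τ)} {t t′ : Tm σ} → s ≈ˢ s′ → t ≈ˢ t′ → s · t ≈ˢ s′ · t′
  ≈ˢ-mono (var-spine s≈s′)                t≈t′ = var-spine (var-app s≈s′ t≈t′)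
  ≈ˢ-mono (fun-spine f g f≡g πf≗πg s≈s′) t≈t′ =
    fun-spine f g f≡g πf≗πg (fun-app s≈s′ (λ _ → t≈t′))

  ≈ˢ-refl : ∀ {σ} (s : Tm σ) → s ≈ˢ s
  ≈ˢ-refl (var x) = var-spine (var-head x)
  ≈ˢ-refl (fun f) = fun-spine f f (≡ᵖ-refl _) (λ _ → refl) fun-head
  ≈ˢ-refl (s · t) = ≈ˢ-mono (≈ˢ-refl s) (≈ˢ-refl t)

  ≈ˢ-sym : ∀ {σ} {s t : Tm σ} → s ≈ˢ t → t ≈ˢ s
  VarSpine≈-sym : ∀ {σ} {s t : Tm σ} → VarSpine≈ s t → VarSpine≈ t s
  FunSpine≈-sym : ∀ {ρ σ} {f g : Fun ρ} {P Q : ℕ → Bool} {i} {s t : Tm σ} →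
                  P ≗ Q → FunSpine≈ f g P i s t → FunSpine≈ g f Q i t s

  ≈ˢ-sym (var-spine s≈t)                = var-spine (VarSpine≈-sym s≈t)
  ≈ˢ-sym (fun-spine f g f≡g πf≗πg s≈t) =
    fun-spine g f (swap f≡g) (λ k → sym (πf≗πg k)) (FunSpine≈-sym πf≗πg s≈t)

  VarSpine≈-sym (var-head x)      = var-head x
  VarSpine≈-sym (var-app s≈t a≈b) = var-app (VarSpine≈-sym s≈t) (≈ˢ-sym a≈b)

  FunSpine≈-sym P≗Q fun-head          = fun-head
  FunSpine≈-sym P≗Q (fun-app s≈t a≈b) =
    fun-app (FunSpine≈-sym P≗Q s≈t) (λ i∈Q → ≈ˢ-sym (a≈b (trans (P≗Q _) i∈Q)))

  VarSpine≈-FunSpine≈-disjoint : ∀ {ρ σ} {f g : Fun ρ} {P i} {s t u : Tm σ} →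
                                 VarSpine≈ s t → FunSpine≈ f g P i t u → ⊥
  VarSpine≈-FunSpine≈-disjoint (var-app s≈t _) (fun-app t≈u _) =
    VarSpine≈-FunSpine≈-disjoint s≈t t≈u

  FunSpine≈-VarSpine≈-disjoint : ∀ {ρ σ} {f g : Fun ρ} {P i} {s t u : Tm σ} →
                                 FunSpine≈ f g P i s t → VarSpine≈ t u → ⊥
  FunSpine≈-VarSpine≈-disjoint (fun-app s≈t _) (var-app t≈u _) =
    FunSpine≈-VarSpine≈-disjoint s≈t t≈u

  FunSpine≈-middle-head : ∀ {ρ ρ′ σ} {f g : Fun ρ} {g′ h : Fun ρ′} {P Q i j} {s t u : Tm σ} →
                          FunSpine≈ f g P i s t → FunSpine≈ g′ h Q j t u →
                          _≡_ {A = FSym} (ρ , g) (ρ′ , g′) × i ≡ j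
  FunSpine≈-middle-head fun-head fun-head = refl , refl
  FunSpine≈-middle-head (fun-app s≈t _) (fun-app t≈u _) with FunSpine≈-middle-head s≈t t≈u
  ... | g≡g′ , refl = g≡g′ , refl

  ≈ˢ-trans : ∀ {σ} {s t u : Tm σ} → s ≈ˢ t → t ≈ˢ u → s ≈ˢ u
  VarSpine≈-trans : ∀ {σ} {s t u : Tm σ} → VarSpine≈ s t → VarSpine≈ t u → VarSpine≈ s u
  FunSpine≈-trans : ∀ {ρ σ} {f g h : Fun ρ} {P Q : ℕ → Bool} {i} {s t u : Tm σ} →
                    P ≗ Q → FunSpine≈ f g P i s t → FunSpine≈ g h Q i t u → FunSpine≈ f h P i s u

  ≈ˢ-trans (var-spine s≈t) (var-spine t≈u) = var-spine (VarSpine≈-trans s≈t t≈u)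
  ≈ˢ-trans (var-spine s≈t) (fun-spine _ _ _ _ t≈u) with () ← VarSpine≈-FunSpine≈-disjoint s≈t t≈u
  ≈ˢ-trans (fun-spine _ _ _ _ s≈t) (var-spine t≈u) with () ← FunSpine≈-VarSpine≈-disjoint s≈t t≈u
  ≈ˢ-trans (fun-spine f g f≡g πf≗πg s≈t) (fun-spine _ h g≡h πg≗πh t≈u)
    with refl , refl ← FunSpine≈-middle-head s≈t t≈u =
    fun-spine f h (≡ᵖ-trans f≡g g≡h) (λ k → trans (πf≗πg k) (πg≗πh k))
              (FunSpine≈-trans πf≗πg s≈t t≈u)

  VarSpine≈-trans (var-head x)      (var-head x)      = var-head x
  VarSpine≈-trans (var-app s≈t a≈b) (var-app t≈u b≈c) =
    var-app (VarSpine≈-trans s≈t t≈u) (≈ˢ-trans a≈b b≈c)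

  FunSpine≈-trans P≗Q fun-head          fun-head          = fun-head
  FunSpine≈-trans P≗Q (fun-app s≈t a≈b) (fun-app t≈u b≈c) =
    fun-app (FunSpine≈-trans P≗Q s≈t t≈u)
            (λ i∈P → ≈ˢ-trans (a≈b i∈P) (b≈c (trans (sym (P≗Q _)) i∈P)))

  ≈ˢ-subst : ∀ {σ} {s t : Tm σ} (γ : Subst) → s ≈ˢ t → s [ γ ] ≈ˢ t [ γ ]
  VarSpine≈-subst : ∀ {σ} {s t : Tm σ} (γ : Subst) → VarSpine≈ s t → s [ γ ] ≈ˢ t [ γ ]
  FunSpine≈-subst : ∀ {ρ σ} {f g : Fun ρ} {P i} {s t : Tm σ} (γ : Subst) →
                    FunSpine≈ f g P i s t → FunSpine≈ f g P i (s [ γ ]) (t [ γ ])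

  ≈ˢ-subst γ (var-spine s≈t)                = VarSpine≈-subst γ s≈t
  ≈ˢ-subst γ (fun-spine f g f≡g πf≗πg s≈t) = fun-spine f g f≡g πf≗πg (FunSpine≈-subst γ s≈t)

  VarSpine≈-subst γ (var-head x)      = ≈ˢ-refl _
  VarSpine≈-subst γ (var-app s≈t a≈b) = ≈ˢ-mono (VarSpine≈-subst γ s≈t) (≈ˢ-subst γ a≈b)

  FunSpine≈-subst γ fun-head          = fun-head
  FunSpine≈-subst γ (fun-app s≈t a≈b) =
    fun-app (FunSpine≈-subst γ s≈t) (λ i∈P → ≈ˢ-subst γ (a≈b i∈P))

lemma2 : (S : Setting) → let open Terms S in
           (∀ {σ} {s t u : Tm σ} → s ≈ t → t ≈ u → s ≈ u)
         × (∀ {σ} (s : Tm σ) → s ≈ s)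
         × (∀ {σ} {s t : Tm σ} → s ≈ t → t ≈ s)
         × (∀ {σ τ} {s s′ : Tm (σ ⇒ τ)} {t t′ : Tm σ} →
              s ≈ s′ → t ≈ t′ → s · t ≈ s′ · t′)
         × (∀ {σ} {s t : Tm σ} (γ : Subst) → s ≈ t → s [ γ ] ≈ t [ γ ])
lemma2 S =
    (λ s≈t t≈u → ≈ˢ⇒≈ (≈ˢ-trans (≈⇒≈ˢ s≈t) (≈⇒≈ˢ t≈u)))
  , (λ s → ≈ˢ⇒≈ (≈ˢ-refl s))
  , (λ s≈t → ≈ˢ⇒≈ (≈ˢ-sym (≈⇒≈ˢ s≈t)))
  , (λ s≈s′ t≈t′ → ≈ˢ⇒≈ (≈ˢ-mono (≈⇒≈ˢ s≈s′) (≈⇒≈ˢ t≈t′)))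
  , (λ γ s≈t → ≈ˢ⇒≈ (≈ˢ-subst γ (≈⇒≈ˢ s≈t)))
  where open SpineEquivalence S
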